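{- For every $n\geq 2$, the number of shallow $132$-avoiding centrosymmetric permutations of length $n$ is $\lceil (n+1)/2\rceil$.
   Context: For $\pi=\pi_1\cdots\pi_n \in S_n$: $D(\pi)=\sum_{i=1}^n|\pi_i-i|$; $I(\pi)=|\{(i,j): i<j,\ \pi_i>\pi_j\}|$; $T(\pi)=n-\mathrm{cyc}(\pi)$ where $\mathrm{cyc}(\pi)$ is the number of cycles of $\pi$. $\pi$ is shallow if $I(\pi)+T(\pi)=D(\pi)$. $\pi$ avoids $132$ if there are no $i<j<k$ with $\pi_i<\pi_k<\pi_j$. The reverse-complement $\pi^{rc}$ is defined by $\pi^{rc}_{n+1-i}=n+1-\pi_i$; $\pi$ is centrosymmetric if $\pi=\pi^{rc}$. -}

module Defs where

open import Data.Nat using (ℕ; zero; suc; _+_; _∸_; _<ᵇ_; _≤ᵇ_; ∣_-_∣)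
open import Data.Bool using (Bool; true; false; if_then_else_; _∧_)
open import Data.Fin using (Fin; toℕ; opposite)
open import Data.Vec using (Vec; lookup)
open import Data.List using (List; map; allFin; upTo; length; filter)
open import Data.Nat.ListAction using (sum)
open import Data.Bool.ListAction using (and)
open import Data.Product using (_×_; ∃-syntax)
open import Relation.Binary.PropositionalEquality using (_≡_)
open import Relation.Nullary using (¬_)
open import Function using (id)

-- A word π = π₁⋯πₙ of length n with letters in Fin n (0-based: letter k stands
-- for k+1, position i stands for i+1).  It is a permutation iff injective.
Word : ℕ → Set
Word n = Vec (Fin n) n

IsPerm : ∀ {n} → Word n → Set
IsPerm {n} π = ∀ (i j : Fin n) → lookup π i ≡ lookup π j → i ≡ j

val : ∀ {n} → Word n → Fin n → ℕ
val π i = toℕ (lookup π i)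

b2n : Bool → ℕ
b2n true = 1
b2n false = 0

-- D(π) = Σ |π_i - i|   (shifting both by 1 does not change differences)
D : ∀ {n} → Word n → ℕ
D {n} π = sum (map (λ i → ∣ val π i - toℕ i ∣) (allFin n))

I : ∀ {n} → Word n → ℕ
I {n} π = sum (map (λ i → sum (map (λ j →
            b2n ((toℕ i <ᵇ toℕ j) ∧ (val π j <ᵇ val π i))) (allFin n))) (allFin n))

iter : ∀ {n} → Word n → ℕ → Fin n → Fin n
iter π zero i = i
iter π (suc k) i = lookup π (iter π k i)

-- i is the least element of its cycle: i ≤ π^k(i) for all k < n
-- (every cycle has length ≤ n, so k < n covers the whole cycle)
isCycleMin : ∀ {n} → Word n → Fin n → Bool
isCycleMin {n} π i = and (map (λ k → toℕ i ≤ᵇ toℕ (iter π k i)) (upTo n))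

-- cyc(π) = number of cycles = number of cycle minima
cyc : ∀ {n} → Word n → ℕ
cyc {n} π = sum (map (λ i → b2n (isCycleMin π i)) (allFin n))

T : ∀ {n} → Word n → ℕ
T {n} π = n ∸ cyc π

Shallow : ∀ {n} → Word n → Set
Shallow π = I π + T π ≡ D π

Avoids132 : ∀ {n} → Word n → Set
Avoids132 {n} π = ¬ (∃[ i ] ∃[ j ] ∃[ k ]
  ((toℕ i Data.Nat.< toℕ j) × (toℕ j Data.Nat.< toℕ k) ×
   (val π i Data.Nat.< val π k) × (val π k Data.Nat.< val π j)))

-- reverse-complement: π^rc_{n+1-i} = n+1-π_i  (0-based: opposite)
rc : ∀ {n} → Word n → Word n
rc {n} π = Data.Vec.tabulate (λ i → opposite (lookup π (opposite i)))

Centrosymmetric : ∀ {n} → Word n → Set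
Centrosymmetric π = π ≡ rc π

Good : ∀ {n} → Word n → Set
Good π = IsPerm π × Shallow π × Avoids132 π × Centrosymmetric π

{-# OPTIONS --safe #-}
-- A 132-avoiding centrosymmetric permutation f of {0, …, n ∸ 1} also avoids 213, which
-- forces it to begin with an increasing run f 0, f 0 + 1, …, n ∸ 1 of length c = n ∸ f 0.
-- Centrosymmetry then leaves two shapes: f is the identity, or f = ι_c ⊖ g ⊖ ι_c with g of
-- the same kind on the middle m = n ∸ 2c points. In the second case
-- I + T = (I + T)(g) + 2cm + c² + c while D = D(g) + 2cm + 2c², so by induction I + T ≤ D,
-- with equality exactly when c = 1 and g is shallow. The shallow ones are therefore the
-- involutions (0 n∸1)(1 n∸2)⋯(k∸1 n∸k) with k ≤ ⌊ n /2⌋, and there are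
-- ⌊ n /2⌋ + 1 = ⌈ (n + 1) /2⌉ of them.
module Submission where

open import Defs
open import Data.Nat using (ℕ; _≤_; ⌈_/2⌉; suc)
open import Data.List using (List; length)
open import Data.List.Membership.Propositional using (_∈_)
open import Data.List.Relation.Unary.Unique.Propositional using (Unique)
open import Data.Product using (Σ; _×_)
open import Function.Bundles using (_⇔_)
open import Relation.Binary.PropositionalEquality using (_≡_)

open import Data.Nat using (zero; _+_; >-nonZero; _*_; _∸_; _<_; _<ᵇ_; _≤ᵇ_; ∣_-_∣; z≤n; s≤s; _≟_; _≤?_; _<?_; ⌊_/2⌋)
open import Data.Nat.Properties
open import Data.Nat.Induction using (<-rec)
open import Data.Nat.Tactic.RingSolver using (solve-∀)
open import Data.Bool using (Bool; true; false; _∧_; if_then_else_)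
open import Data.Bool.Properties using (∧-assoc; ∧-idem; ∧-identityʳ)
open import Data.Empty using (⊥; ⊥-elim)
open import Data.Product using (_,_; ∃-syntax)
open import Data.Sum using (_⊎_; inj₁; inj₂)
open import Relation.Binary.PropositionalEquality using (refl; sym; trans; cong; cong₂; subst; subst₂; _≢_; module ≡-Reasoning)
open import Relation.Binary.Definitions using (tri<; tri≈; tri>)
open import Relation.Nullary using (yes; no)
open import Function using (_∘_)
open import Data.Fin as Fin using (Fin; toℕ; fromℕ<; opposite; punchOut)
open import Data.Fin.Properties using (toℕ-injective; toℕ-fromℕ<; toℕ<n; opposite-prop; any?; pigeonhole; punchOut-injective) renaming (_≟_ to _≟ᶠ_)
open import Data.Vec using (Vec; lookup; tabulate; []; _∷_)
open import Data.Vec.Properties using (lookup∘tabulate; tabulate∘lookup; tabulate-cong)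
open import Data.List using ([]; _∷_; map; allFin; applyUpTo)
open import Data.List.Properties using (map-tabulate; length-applyUpTo)
open import Data.List.Membership.Propositional.Properties using (∈-applyUpTo⁺; ∈-applyUpTo⁻)
open import Data.List.Relation.Unary.All using (All; []; _∷_)
import Data.List.Relation.Unary.All.Properties as All
import Data.List.Relation.Unary.Unique.Propositional.Properties as Unique
open import Data.Nat.ListAction using (sum)
open import Data.Bool.ListAction using (and)
open import Function.Bundles using (mk⇔)

∑< : ℕ → (ℕ → ℕ) → ℕ
∑< zero    h = 0
∑< (suc n) h = h 0 + ∑< n (h ∘ suc)

∑<-cong : ∀ n {h h′ : ℕ → ℕ} → (∀ i → i < n → h i ≡ h′ i) → ∑< n h ≡ ∑< n h′
∑<-cong zero    h≗h′ = refl
∑<-cong (suc n) h≗h′ = cong₂ _+_ (h≗h′ 0 (s≤s z≤n)) (∑<-cong n (λ i i<n → h≗h′ (suc i) (s≤s i<n)))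

∑<-const : ∀ n k {h : ℕ → ℕ} → (∀ i → i < n → h i ≡ k) → ∑< n h ≡ n * k
∑<-const zero    k h≗k = refl
∑<-const (suc n) k h≗k = cong₂ _+_ (h≗k 0 (s≤s z≤n)) (∑<-const n k (λ i i<n → h≗k (suc i) (s≤s i<n)))

∑<-zero : ∀ n {h : ℕ → ℕ} → (∀ i → i < n → h i ≡ 0) → ∑< n h ≡ 0
∑<-zero n h≗0 = trans (∑<-const n 0 h≗0) (*-zeroʳ n)

∑<-one : ∀ n {h : ℕ → ℕ} → (∀ i → i < n → h i ≡ 1) → ∑< n h ≡ n
∑<-one n h≗1 = trans (∑<-const n 1 h≗1) (*-identityʳ n)

∑<-+ : ∀ n (h h′ : ℕ → ℕ) → ∑< n (λ i → h i + h′ i) ≡ ∑< n h + ∑< n h′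
∑<-+ zero    h h′ = refl
∑<-+ (suc n) h h′ = trans (cong (h 0 + h′ 0 +_) (∑<-+ n (h ∘ suc) (h′ ∘ suc))) (+-+-interchange (h 0) (h′ 0) _ _)
  where
  +-+-interchange : ∀ a b c d → a + b + (c + d) ≡ a + c + (b + d)
  +-+-interchange = solve-∀

∑<-split : ∀ a b (h : ℕ → ℕ) → ∑< (a + b) h ≡ ∑< a h + ∑< b (λ i → h (a + i))
∑<-split zero    b h = refl
∑<-split (suc a) b h = trans (cong (h 0 +_) (∑<-split a b (h ∘ suc))) (sym (+-assoc (h 0) _ _))

∑<-split₃ : ∀ c m (h : ℕ → ℕ) →
  ∑< (c + m + c) h ≡ ∑< c h + ∑< m (λ j → h (c + j)) + ∑< c (λ i → h (c + m + i))
∑<-split₃ c m h = trans (∑<-split (c + m) c h) (cong (_+ ∑< c (λ i → h (c + m + i))) (∑<-split c m h))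

<⇒<ᵇ≡true : ∀ {m n} → m < n → (m <ᵇ n) ≡ true
<⇒<ᵇ≡true {zero}  {suc n} _         = refl
<⇒<ᵇ≡true {suc m} {suc n} (s≤s m<n) = <⇒<ᵇ≡true m<n

≥⇒<ᵇ≡false : ∀ {m n} → n ≤ m → (m <ᵇ n) ≡ false
≥⇒<ᵇ≡false {m}     {zero}  _         = refl
≥⇒<ᵇ≡false {suc m} {suc n} (s≤s n≤m) = ≥⇒<ᵇ≡false n≤m

≤⇒≤ᵇ≡true : ∀ {m n} → m ≤ n → (m ≤ᵇ n) ≡ true
≤⇒≤ᵇ≡true {zero}  _   = refl
≤⇒≤ᵇ≡true {suc m} m≤n = <⇒<ᵇ≡true m≤n

>⇒≤ᵇ≡false : ∀ {m n} → n < m → (m ≤ᵇ n) ≡ false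
>⇒≤ᵇ≡false {suc m} (s≤s n≤m) = ≥⇒<ᵇ≡false n≤m

+-cancelˡ-<ᵇ : ∀ c x y → (c + x <ᵇ c + y) ≡ (x <ᵇ y)
+-cancelˡ-<ᵇ zero    x y = refl
+-cancelˡ-<ᵇ (suc c) x y = +-cancelˡ-<ᵇ c x y

<ᵇ-asym : ∀ i j → ((i <ᵇ j) ∧ (j <ᵇ i)) ≡ false
<ᵇ-asym i j with i <? j
... | yes i<j rewrite <⇒<ᵇ≡true i<j | ≥⇒<ᵇ≡false (<⇒≤ i<j) = refl
... | no  i≮j rewrite ≥⇒<ᵇ≡false (≮⇒≥ i≮j) = refl

b2n-≤ᵇ+b2n-<ᵇ : ∀ a b → b2n (a ≤ᵇ b) + b2n (b <ᵇ a) ≡ 1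
b2n-≤ᵇ+b2n-<ᵇ a b with a ≤? b
... | yes a≤b rewrite ≤⇒≤ᵇ≡true a≤b | ≥⇒<ᵇ≡false a≤b = refl
... | no  a≰b rewrite >⇒≤ᵇ≡false (≰⇒> a≰b) | <⇒<ᵇ≡true (≰⇒> a≰b) = refl

b2n-∧≡1 : ∀ {a b} → a ≡ true → b ≡ true → b2n (a ∧ b) ≡ 1
b2n-∧≡1 refl refl = refl

b2n-∧≡0 : ∀ {a} b → a ≡ false → b2n (a ∧ b) ≡ 0
b2n-∧≡0 b refl = refl

∧-and-absorb : ∀ b {ys : List Bool} → All (λ y → y ≡ true ⊎ y ≡ b) ys → b ∧ and ys ≡ b
∧-and-absorb b []                = ∧-identityʳ b
∧-and-absorb b (inj₁ refl ∷ ys≈) = ∧-and-absorb b ys≈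
∧-and-absorb b {_ ∷ ys} (inj₂ refl ∷ ys≈) =
  trans (sym (∧-assoc b b (and ys))) (trans (cong (_∧ and ys) (∧-idem b)) (∧-and-absorb b ys≈))

inversionsFrom : ℕ → (ℕ → ℕ) → ℕ → ℕ
inversionsFrom n f i = ∑< n (λ j → b2n ((i <ᵇ j) ∧ (f j <ᵇ f i)))

inversions : ℕ → (ℕ → ℕ) → ℕ
inversions n f = ∑< n (inversionsFrom n f)

deficiencies : ℕ → (ℕ → ℕ) → ℕ
deficiencies n f = ∑< n (λ i → b2n (f i <ᵇ i))

displacement : ℕ → (ℕ → ℕ) → ℕ
displacement n f = ∑< n (λ i → ∣ f i - i ∣)

-- T is replaced by the number of i with f i < i, which equals n − cyc(f) for an involution f.
IsShallow : ℕ → (ℕ → ℕ) → Set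
IsShallow n f = inversions n f + deficiencies n f ≡ displacement n f

identity-statistics : ∀ n f → (∀ i → i < n → f i ≡ i) →
  inversions n f ≡ 0 × deficiencies n f ≡ 0 × displacement n f ≡ 0
identity-statistics n f f≗id =
    ∑<-zero n (λ i i<n → ∑<-zero n (λ j j<n →
      trans (cong₂ (λ u v → b2n ((i <ᵇ j) ∧ (u <ᵇ v))) (f≗id j j<n) (f≗id i i<n)) (cong b2n (<ᵇ-asym i j))))
  , ∑<-zero n (λ i i<n → cong b2n (trans (cong (_<ᵇ i) (f≗id i i<n)) (≥⇒<ᵇ≡false (≤-refl {i}))))
  , ∑<-zero n (λ i i<n → trans (cong (∣_- i ∣) (f≗id i i<n)) (∣n-n∣≡0 i))

identity-shallow : ∀ n f → (∀ i → i < n → f i ≡ i) → IsShallow n f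
identity-shallow n f f≗id with identity-statistics n f f≗id
... | I≡0 , T≡0 , D≡0 = trans (cong₂ _+_ I≡0 T≡0) (sym D≡0)

-- f is the skew sum ι_c ⊖ g ⊖ ι_c of two increasing runs of length c around g.
record Block (c m : ℕ) (f g : ℕ → ℕ) : Set where
  field
    top      : ∀ i → i < c → f i ≡ m + c + i
    middle   : ∀ j → j < m → f (c + j) ≡ c + g j
    bottom   : ∀ i → i < c → f (c + m + i) ≡ i
    middle-< : ∀ j → j < m → g j < m

data Region (c m : ℕ) : ℕ → Set where
  in-top    : ∀ {i} → i < c → Region c m i
  in-middle : ∀ {j} → j < m → Region c m (c + j)
  in-bottom : ∀ {i} → i < c → Region c m (c + m + i)

region : ∀ c m {i} → i < c + m + c → Region c m i
region c m {i} i<n with i <? c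
... | yes i<c = in-top i<c
... | no  i≮c with i ∸ c <? m
...   | yes j<m = subst (Region c m) (m+[n∸m]≡n (≮⇒≥ i≮c)) (in-middle j<m)
...   | no  j≮m = subst (Region c m) c+m+l≡i (in-bottom l<c)
  where
  l = i ∸ c ∸ m
  c+m+l≡i : c + m + l ≡ i
  c+m+l≡i = trans (+-assoc c m l) (trans (cong (c +_) (m+[n∸m]≡n (≮⇒≥ j≮m))) (m+[n∸m]≡n (≮⇒≥ i≮c)))
  l<c : l < c
  l<c = +-cancelˡ-< (c + m) l c (subst (_< c + m + c) (sym c+m+l≡i) i<n)

module _ {c m : ℕ} {f g : ℕ → ℕ} (B : Block c m f g) where
  open Block B

  block-involutive : (∀ j → j < m → g (g j) ≡ j) → ∀ i → i < c + m + c → f (f i) ≡ i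
  block-involutive g-invol i i<n with region c m i<n
  ... | in-top i<c = trans (cong f (trans (top i i<c) (cong (_+ i) (+-comm m c)))) (bottom i i<c)
  ... | in-middle {j} j<m = begin
    f (f (c + j))   ≡⟨ cong f (middle j j<m) ⟩
    f (c + g j)     ≡⟨ middle (g j) (middle-< j j<m) ⟩
    c + g (g j)     ≡⟨ cong (c +_) (g-invol j j<m) ⟩
    c + j           ∎
    where open ≡-Reasoning
  ... | in-bottom {l} l<c = begin
    f (f (c + m + l))   ≡⟨ cong f (bottom l l<c) ⟩
    f l                 ≡⟨ top l l<c ⟩
    m + c + l           ≡⟨ cong (_+ l) (+-comm m c) ⟩
    c + m + l           ∎
    where open ≡-Reasoning

  block-displacement : displacement (c + m + c) f ≡ c * (m + c) + displacement m g + c * (m + c)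
  block-displacement = trans (∑<-split₃ c m _) (cong₂ _+_ (cong₂ _+_ top-part middle-part) bottom-part)
    where
    ∣x+i-i∣≡x : ∀ x i → ∣ x + i - i ∣ ≡ x
    ∣x+i-i∣≡x x i = trans (cong (∣_- i ∣) (+-comm x i)) (trans (∣-∣-comm (i + x) i) (∣m-m+n∣≡n i x))
    c+m+i≡m+c+i : ∀ i → c + m + i ≡ m + c + i
    c+m+i≡m+c+i i = cong (_+ i) (+-comm c m)
    top-part : ∑< c (λ i → ∣ f i - i ∣) ≡ c * (m + c)
    top-part = ∑<-const c (m + c) λ i i<c →
      trans (cong (∣_- i ∣) (top i i<c)) (∣x+i-i∣≡x (m + c) i)
    middle-part : ∑< m (λ j → ∣ f (c + j) - (c + j) ∣) ≡ displacement m g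
    middle-part = ∑<-cong m λ j j<m →
      trans (cong (∣_- c + j ∣) (middle j j<m)) (∣m+n-m+o∣≡∣n-o∣ c (g j) j)
    bottom-part : ∑< c (λ i → ∣ f (c + m + i) - (c + m + i) ∣) ≡ c * (m + c)
    bottom-part = ∑<-const c (m + c) λ i i<c →
      trans (cong (∣_- c + m + i ∣) (bottom i i<c))
        (trans (∣-∣-comm i _) (trans (cong (∣_- i ∣) (c+m+i≡m+c+i i)) (∣x+i-i∣≡x (m + c) i)))

  block-deficiencies : 1 ≤ c → deficiencies (c + m + c) f ≡ deficiencies m g + c
  block-deficiencies 1≤c =
    trans (∑<-split₃ c m _) (trans (cong₂ _+_ (cong₂ _+_ top-part middle-part) bottom-part)
                                   (cong (_+ c) (+-identityˡ _)))
    where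
    top-part : ∑< c (λ i → b2n (f i <ᵇ i)) ≡ 0
    top-part = ∑<-zero c λ i i<c →
      cong b2n (trans (cong (_<ᵇ i) (top i i<c)) (≥⇒<ᵇ≡false (m≤n+m i (m + c))))
    middle-part : ∑< m (λ j → b2n (f (c + j) <ᵇ (c + j))) ≡ deficiencies m g
    middle-part = ∑<-cong m λ j j<m →
      cong b2n (trans (cong (_<ᵇ c + j) (middle j j<m)) (+-cancelˡ-<ᵇ c (g j) j))
    bottom-part : ∑< c (λ i → b2n (f (c + m + i) <ᵇ (c + m + i))) ≡ c
    bottom-part = ∑<-one c λ i i<c →
      cong b2n (trans (cong (_<ᵇ c + m + i) (bottom i i<c))
        (<⇒<ᵇ≡true (≤-trans (s≤s (m≤n+m i m)) (+-monoˡ-≤ i (+-monoˡ-≤ m 1≤c)))))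

  private
    inv : ℕ → ℕ → ℕ
    inv i j = b2n ((i <ᵇ j) ∧ (f j <ᵇ f i))

    inv-at : ∀ {i j u v} → f j ≡ u → f i ≡ v → inv i j ≡ b2n ((i <ᵇ j) ∧ (u <ᵇ v))
    inv-at {i} {j} = cong₂ (λ u v → b2n ((i <ᵇ j) ∧ (u <ᵇ v)))

    inv≡1 : ∀ {i j} → i < j → f j < f i → inv i j ≡ 1
    inv≡1 i<j fj<fi = b2n-∧≡1 (<⇒<ᵇ≡true i<j) (<⇒<ᵇ≡true fj<fi)

    inv≡0 : ∀ {i j} → j ≤ i → inv i j ≡ 0
    inv≡0 {i} {j} j≤i = b2n-∧≡0 (f j <ᵇ f i) (≥⇒<ᵇ≡false j≤i)

    inv-order-preserving : ∀ i j → (f j <ᵇ f i) ≡ (j <ᵇ i) → inv i j ≡ 0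
    inv-order-preserving i j same = trans (cong (λ b → b2n ((i <ᵇ j) ∧ b)) same) (cong b2n (<ᵇ-asym i j))

  block-inversionsFrom-top : ∀ i → i < c → inversionsFrom (c + m + c) f i ≡ m + c
  block-inversionsFrom-top i i<c = trans (∑<-split₃ c m _) (cong₂ _+_ (cong₂ _+_ top-part middle-part) bottom-part)
    where
    fi : f i ≡ m + c + i
    fi = top i i<c
    top-part : ∑< c (inv i) ≡ 0
    top-part = ∑<-zero c λ j j<c → inv-order-preserving i j
      (trans (cong₂ _<ᵇ_ (top j j<c) fi) (+-cancelˡ-<ᵇ (m + c) j i))
    middle-part : ∑< m (λ j → inv i (c + j)) ≡ m
    middle-part = ∑<-one m λ j j<m → inv≡1 (<-≤-trans i<c (m≤m+n c j))
      (subst₂ _<_ (sym (middle j j<m)) (sym fi)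
        (<-≤-trans (+-monoʳ-< c (middle-< j j<m)) (subst (_≤ m + c + i) (+-comm m c) (m≤m+n (m + c) i))))
    bottom-part : ∑< c (λ j → inv i (c + m + j)) ≡ c
    bottom-part = ∑<-one c λ j j<c → inv≡1 (<-≤-trans i<c (≤-trans (m≤m+n c m) (m≤m+n (c + m) j)))
      (subst₂ _<_ (sym (bottom j j<c)) (sym fi) (<-≤-trans j<c (≤-trans (m≤n+m c m) (m≤m+n (m + c) i))))

  block-inversionsFrom-middle : ∀ i → i < m → inversionsFrom (c + m + c) f (c + i) ≡ inversionsFrom m g i + c
  block-inversionsFrom-middle i i<m = trans (∑<-split₃ c m _) (cong₂ _+_ (cong₂ _+_ top-part middle-part) bottom-part)
    where
    top-part : ∑< c (inv (c + i)) ≡ 0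
    top-part = ∑<-zero c λ j j<c → inv≡0 (≤-trans (<⇒≤ j<c) (m≤m+n c i))
    middle-part : ∑< m (λ j → inv (c + i) (c + j)) ≡ inversionsFrom m g i
    middle-part = ∑<-cong m λ j j<m → trans (inv-at (middle j j<m) (middle i i<m))
      (cong₂ (λ u v → b2n (u ∧ v)) (+-cancelˡ-<ᵇ c i j) (+-cancelˡ-<ᵇ c (g j) (g i)))
    bottom-part : ∑< c (λ j → inv (c + i) (c + m + j)) ≡ c
    bottom-part = ∑<-one c λ j j<c → inv≡1 (≤-trans (+-monoʳ-< c i<m) (m≤m+n (c + m) j))
      (subst₂ _<_ (sym (bottom j j<c)) (sym (middle i i<m)) (<-≤-trans j<c (m≤m+n c (g i))))

  block-inversionsFrom-bottom : ∀ i → i < c → inversionsFrom (c + m + c) f (c + m + i) ≡ 0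
  block-inversionsFrom-bottom i i<c = trans (∑<-split₃ c m _) (cong₂ _+_ (cong₂ _+_ top-part middle-part) bottom-part)
    where
    top-part : ∑< c (inv (c + m + i)) ≡ 0
    top-part = ∑<-zero c λ j j<c → inv≡0 (≤-trans (<⇒≤ j<c) (≤-trans (m≤m+n c m) (m≤m+n (c + m) i)))
    middle-part : ∑< m (λ j → inv (c + m + i) (c + j)) ≡ 0
    middle-part = ∑<-zero m λ j j<m → inv≡0 (≤-trans (<⇒≤ (+-monoʳ-< c j<m)) (m≤m+n (c + m) i))
    bottom-part : ∑< c (λ j → inv (c + m + i) (c + m + j)) ≡ 0
    bottom-part = ∑<-zero c λ j j<c → inv-order-preserving (c + m + i) (c + m + j)
      (trans (cong₂ _<ᵇ_ (bottom j j<c) (bottom i i<c)) (sym (+-cancelˡ-<ᵇ (c + m) j i)))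

  block-inversions : inversions (c + m + c) f ≡ c * (m + c) + (inversions m g + m * c)
  block-inversions =
    trans (∑<-split₃ c m _)
      (trans (cong₂ _+_ (cong₂ _+_ (∑<-const c (m + c) block-inversionsFrom-top) middle-rows)
                        (∑<-zero c block-inversionsFrom-bottom))
             (+-identityʳ _))
    where
    middle-rows : ∑< m (λ i → inversionsFrom (c + m + c) f (c + i)) ≡ inversions m g + m * c
    middle-rows = trans (∑<-cong m block-inversionsFrom-middle)
      (trans (∑<-+ m (inversionsFrom m g) (λ _ → c)) (cong (inversions m g +_) (∑<-const m c (λ _ _ → refl))))

+-≤-tight : ∀ {a b p q} → a ≤ b → p ≤ q → a + p ≡ b + q → a ≡ b × p ≡ q
+-≤-tight {a} a≤b p≤q a+p≡b+q with m≤n⇒m<n∨m≡n a≤b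
... | inj₁ a<b  = ⊥-elim (<⇒≢ (+-mono-<-≤ a<b p≤q) a+p≡b+q)
... | inj₂ refl = refl , +-cancelˡ-≡ a _ _ a+p≡b+q

module _ {c m : ℕ} {f g : ℕ → ℕ} (1≤c : 1 ≤ c) (B : Block c m f g) where

  private
    K : ℕ
    K = c * m + m * c + c * c

  block-I+T : inversions (c + m + c) f + deficiencies (c + m + c) f
            ≡ (inversions m g + deficiencies m g) + (K + c)
  block-I+T = trans (cong₂ _+_ (block-inversions B) (block-deficiencies B 1≤c)) (rearrange c m _ _)
    where
    rearrange : ∀ c m I T → c * (m + c) + (I + m * c) + (T + c) ≡ (I + T) + (c * m + m * c + c * c + c)
    rearrange = solve-∀

  block-D : displacement (c + m + c) f ≡ displacement m g + (K + c * c)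
  block-D = trans (block-displacement B) (rearrange c m _)
    where
    rearrange : ∀ c m D → c * (m + c) + D + c * (m + c) ≡ D + (c * m + m * c + c * c + c * c)
    rearrange = solve-∀

  private
    c≤c*c : c ≤ c * c
    c≤c*c = m≤m*n c c {{>-nonZero 1≤c}}

    K+c≤K+c*c : K + c ≤ K + c * c
    K+c≤K+c*c = +-monoʳ-≤ K c≤c*c

  block-I+T≤D : inversions m g + deficiencies m g ≤ displacement m g →
    inversions (c + m + c) f + deficiencies (c + m + c) f ≤ displacement (c + m + c) f
  block-I+T≤D g-I+T≤D = subst₂ _≤_ (sym block-I+T) (sym block-D) (+-mono-≤ g-I+T≤D K+c≤K+c*c)

  -- Shallowness leaves no slack in c ≤ c * c.
  block-shallow : inversions m g + deficiencies m g ≤ displacement m g →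
    IsShallow (c + m + c) f → c ≡ 1 × IsShallow m g
  block-shallow g-I+T≤D f-shallow with +-≤-tight g-I+T≤D K+c≤K+c*c (trans (sym block-I+T) (trans f-shallow block-D))
  ... | g-shallow , K+c≡K+c*c =
    *-cancelˡ-≡ c 1 c {{>-nonZero 1≤c}} (trans (sym (+-cancelˡ-≡ K _ _ K+c≡K+c*c)) (sym (*-identityʳ c))) , g-shallow

-- Mirror positions i and n ∸ suc i are encoded as i, j with suc (i + j) ≡ n.
record IsCentro132 (n : ℕ) (f : ℕ → ℕ) : Set where
  field
    injective       : ∀ i j → i < n → j < n → f i ≡ f j → i ≡ j
    surjective      : ∀ v → v < n → ∃[ i ] (i < n × f i ≡ v)
    avoids132       : ∀ i j k → i < j → j < k → k < n → f i < f k → f k < f j → ⊥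
    centrosymmetric : ∀ i j → suc (i + j) ≡ n → suc (f i + f j) ≡ n
open IsCentro132

mirror : ∀ {i n} → i < n → ∃[ j ] (suc (i + j) ≡ n)
mirror {i} {n} i<n = n ∸ suc i , m+[n∸m]≡n i<n

mirrorˡ-< : ∀ {i j n} → suc (i + j) ≡ n → i < n
mirrorˡ-< {i} {j} e = subst (i <_) e (s≤s (m≤m+n i j))

mirrorʳ-< : ∀ {i j n} → suc (i + j) ≡ n → j < n
mirrorʳ-< {i} {j} e = subst (j <_) e (s≤s (m≤n+m j i))

mirror-reverses-< : ∀ {i j i′ j′ n} → suc (i + i′) ≡ n → suc (j + j′) ≡ n → i < j → j′ < i′
mirror-reverses-< {i′ = i′} {j′ = j′} e e′ i<j with j′ <? i′
... | yes j′<i′ = j′<i′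
... | no  j′≮i′ = ⊥-elim (<⇒≢ (+-mono-<-≤ i<j (≮⇒≥ j′≮i′)) (suc-injective (trans e (sym e′))))

mirror-of-top : ∀ {c} m {i i′} → suc (i + i′) ≡ c → suc (i + (m + c + i′)) ≡ c + m + c
mirror-of-top m {i} {i′} refl = arithmetic i i′ m
  where
  arithmetic : ∀ i i′ m → suc (i + (m + suc (i + i′) + i′)) ≡ suc (i + i′) + m + suc (i + i′)
  arithmetic = solve-∀

mirror-of-bottom : ∀ {c} m {i i′} → suc (i + i′) ≡ c → suc (c + m + i + i′) ≡ c + m + c
mirror-of-bottom m {i} {i′} refl = arithmetic i i′ m
  where
  arithmetic : ∀ i i′ m → suc (suc (i + i′) + m + i + i′) ≡ suc (i + i′) + m + suc (i + i′)
  arithmetic = solve-∀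

mirror-shift : ∀ c {m i j} → suc (i + j) ≡ m → suc (c + i + (c + j)) ≡ c + m + c
mirror-shift c {i = i} {j} refl = arithmetic c i j
  where
  arithmetic : ∀ c i j → suc (c + i + (c + j)) ≡ c + suc (i + j) + c
  arithmetic = solve-∀

mirror-unshift : ∀ c m {x y} → suc (c + x + (c + y)) ≡ c + m + c → suc (x + y) ≡ m
mirror-unshift c m {x} {y} e = +-cancelˡ-≡ (c + c) _ _ (trans (arithmetic₁ c x y) (trans e (arithmetic₂ c m)))
  where
  arithmetic₁ : ∀ c x y → c + c + suc (x + y) ≡ suc (c + x + (c + y))
  arithmetic₁ = solve-∀
  arithmetic₂ : ∀ c m → c + m + c ≡ c + c + m
  arithmetic₂ = solve-∀

module _ {n : ℕ} {f : ℕ → ℕ} (G : IsCentro132 n f) where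

  centro132-< : ∀ {i} → i < n → f i < n
  centro132-< i<n with mirror i<n
  ... | j , e = mirrorˡ-< (centrosymmetric G _ j e)

  -- The mirror image of a 213 is a 132.
  avoids213 : ∀ i j k → i < j → j < k → k < n → f j < f i → f i < f k → ⊥
  avoids213 i j k i<j j<k k<n fj<fi fi<fk
    with mirror k<n | mirror (<-trans j<k k<n) | mirror (<-trans i<j (<-trans j<k k<n))
  ... | k′ , ek | j′ , ej | i′ , ei =
    avoids132 G k′ j′ i′ (mirror-reverses-< ej ek j<k) (mirror-reverses-< ei ej i<j) (mirrorʳ-< ei)
      (mirror-reverses-< (centrosymmetric G i i′ ei) (centrosymmetric G k k′ ek) fi<fk)
      (mirror-reverses-< (centrosymmetric G j j′ ej) (centrosymmetric G i i′ ei) fj<fi)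

data Decomposition (n : ℕ) (f : ℕ → ℕ) : Set where
  identity : (∀ i → i < n → f i ≡ i) → Decomposition n f
  block    : ∀ c m g → 1 ≤ c → n ≡ c + m + c → Block c m f g → IsCentro132 m g → Decomposition n f

module InitialRun {n : ℕ} {f : ℕ → ℕ} (G : IsCentro132 n f) {c : ℕ} (f0+c≡n : f 0 + c ≡ n) where

  IsRun : ℕ → Set
  IsRun k = ∀ i → i < k → f i ≡ f 0 + i

  c≤n : c ≤ n
  c≤n = subst (c ≤_) f0+c≡n (m≤n+m c (f 0))

  run-value-< : ∀ {k} → k < c → f 0 + k < n
  run-value-< k<c = subst (_ <_) f0+c≡n (+-monoʳ-< (f 0) k<c)

  run-preimage : ∀ {k} → k ≤ c → IsRun k → ∀ x → x < n → f 0 ≤ f x → f x < f 0 + k → x < k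
  run-preimage {k} k≤c run x x<n f0≤fx fx<f0+k = subst (_< k) d≡x d<k
    where
    d = f x ∸ f 0
    f0+d≡fx : f 0 + d ≡ f x
    f0+d≡fx = m+[n∸m]≡n f0≤fx
    d<k : d < k
    d<k = +-cancelˡ-< (f 0) d k (subst (_< f 0 + k) (sym f0+d≡fx) fx<f0+k)
    d≡x : d ≡ x
    d≡x = injective G d x (<-≤-trans d<k (≤-trans k≤c c≤n)) x<n (trans (run d d<k) f0+d≡fx)

  preimage-after-run : ∀ {k p} → IsRun k → f p ≡ f 0 + k → f k ≢ f 0 + k → k < p
  preimage-after-run {k} {p} run fp≡v fk≢v with <-cmp p k
  ... | tri< p<k _ _  = ⊥-elim (<⇒≢ p<k (+-cancelˡ-≡ (f 0) p k (trans (sym (run p p<k)) fp≡v)))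
  ... | tri≈ _ refl _ = ⊥-elim (fk≢v fp≡v)
  ... | tri> _ _ k<p  = k<p

  -- The next value f 0 + k has a preimage p beyond k; any other value at k
  -- would complete a 132 (through k ∸ 1) or a 213 (through 0) with p.
  run-extends : ∀ k → k < c → IsRun k → f k ≡ f 0 + k
  run-extends zero    _    _   = sym (+-identityʳ (f 0))
  run-extends (suc i) si<c run with surjective G (f 0 + suc i) (run-value-< si<c)
  ... | p , p<n , fp≡v with <-cmp (f (suc i)) (f 0 + suc i)
  ... | tri≈ _ fsi≡v _ = fsi≡v
  ... | tri> _ _ v<fsi = ⊥-elim (avoids132 G i (suc i) p (n<1+n i) (preimage-after-run run fp≡v (>⇒≢ v<fsi)) p<n
          (subst₂ _<_ (sym (run i (n<1+n i))) (sym fp≡v) (+-monoʳ-< (f 0) (n<1+n i)))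
          (subst (_< f (suc i)) (sym fp≡v) v<fsi))
  ... | tri< fsi<v _ _ with f 0 ≤? f (suc i)
  ...   | yes f0≤fsi = ⊥-elim (<-irrefl refl
            (run-preimage (<⇒≤ si<c) run (suc i) (<-≤-trans si<c c≤n) f0≤fsi fsi<v))
  ...   | no  f0≰fsi = ⊥-elim (avoids213 G 0 (suc i) p (s≤s z≤n) (preimage-after-run run fp≡v (<⇒≢ fsi<v)) p<n
            (≰⇒> f0≰fsi) (subst (f 0 <_) (sym fp≡v) (m<m+n (f 0) (s≤s z≤n))))

  initial-run : ∀ k → k ≤ c → IsRun k
  initial-run zero    _    _ ()
  initial-run (suc k) sk≤c i i<sk with m≤n⇒m<n∨m≡n (≤-pred i<sk)
  ... | inj₁ i<k  = initial-run k (≤-trans (n≤1+n k) sk≤c) i i<k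
  ... | inj₂ refl = run-extends i sk≤c (initial-run i (≤-trans (n≤1+n i) sk≤c))

  full-run : IsRun c
  full-run = initial-run c ≤-refl

  f0<c⇒f0≡0 : f 0 < c → f 0 ≡ 0
  f0<c⇒f0≡0 f0<c =
    m+n≡0⇒m≡0 a (+-cancelʳ-≡ (a + c′) (a + a) 0 (suc-injective (trans mirror-values (sym mirror-positions))))
    where
    a = f 0
    c′ = c ∸ 1
    suc-c′≡c : suc c′ ≡ c
    suc-c′≡c = m+[n∸m]≡n (≤-trans (s≤s z≤n) f0<c)
    mirror-positions : suc (a + c′) ≡ n
    mirror-positions = trans (sym (+-suc a c′)) (trans (cong (a +_) suc-c′≡c) f0+c≡n)
    mirror-values : suc (a + a + (a + c′)) ≡ n
    mirror-values = trans
      (cong₂ (λ u v → suc (u + v)) (sym (full-run a f0<c)) (sym (full-run c′ (subst (c′ <_) suc-c′≡c ≤-refl))))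
      (centrosymmetric G a c′ mirror-positions)

  module Peel (c≤f0 : c ≤ f 0) where
    m : ℕ
    m = f 0 ∸ c

    g : ℕ → ℕ
    g j = f (c + j) ∸ c

    c+m≡f0 : c + m ≡ f 0
    c+m≡f0 = m+[n∸m]≡n c≤f0

    n≡c+m+c : n ≡ c + m + c
    n≡c+m+c = trans (sym f0+c≡n) (cong (_+ c) (sym c+m≡f0))

    <c+m+c⇒<n : ∀ {x} → x < c + m + c → x < n
    <c+m+c⇒<n = subst (_ <_) (sym n≡c+m+c)

    middle-<n : ∀ {j} → j < m → c + j < n
    middle-<n {j} j<m = <c+m+c⇒<n (<-≤-trans (+-monoʳ-< c j<m) (m≤m+n (c + m) c))

    top : ∀ i → i < c → f i ≡ m + c + i
    top i i<c = trans (full-run i i<c) (cong (_+ i) (trans (sym c+m≡f0) (+-comm c m)))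

    bottom : ∀ i → i < c → f (c + m + i) ≡ i
    bottom i i<c with mirror i<c
    ... | i′ , e = +-cancelʳ-≡ (f i′) _ _ (suc-injective (trans values (sym positions)))
      where
      positions : suc (i + f i′) ≡ n
      positions = trans (cong (λ u → suc (i + u)) (top i′ (mirrorʳ-< e)))
                        (trans (mirror-of-top m {i} e) (sym n≡c+m+c))
      values : suc (f (c + m + i) + f i′) ≡ n
      values = centrosymmetric G (c + m + i) i′ (trans (mirror-of-bottom m {i} e) (sym n≡c+m+c))

    middle-≥ : ∀ j → j < m → c ≤ f (c + j)
    middle-≥ j j<m with c ≤? f (c + j)
    ... | yes c≤v = c≤v
    ... | no  c≰v = ⊥-elim (<⇒≱ j<m (subst (m ≤_) (sym j≡m+v) (m≤m+n m v)))
      where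
      v = f (c + j)
      v<c : v < c
      v<c = ≰⇒> c≰v
      j≡m+v : j ≡ m + v
      j≡m+v = +-cancelˡ-≡ c j (m + v)
        (trans (injective G (c + j) (c + m + v) (middle-<n j<m) (<c+m+c⇒<n (+-monoʳ-< (c + m) v<c)) (sym (bottom v v<c)))
               (+-assoc c m v))

    middle-<c+m : ∀ j → j < m → f (c + j) < c + m
    middle-<c+m j j<m with f (c + j) <? c + m
    ... | yes v<c+m = v<c+m
    ... | no  v≮c+m = ⊥-elim (<⇒≱ (run-preimage ≤-refl full-run (c + j) (middle-<n j<m) f0≤v v<f0+c) (m≤m+n c j))
      where
      f0≤v : f 0 ≤ f (c + j)
      f0≤v = subst (_≤ f (c + j)) c+m≡f0 (≮⇒≥ v≮c+m)
      v<f0+c : f (c + j) < f 0 + c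
      v<f0+c = subst (f (c + j) <_) (sym f0+c≡n) (centro132-< G (middle-<n j<m))

    middle : ∀ j → j < m → f (c + j) ≡ c + g j
    middle j j<m = sym (m+[n∸m]≡n (middle-≥ j j<m))

    middle-< : ∀ j → j < m → g j < m
    middle-< j j<m = +-cancelˡ-< c (g j) m (subst (_< c + m) (middle j j<m) (middle-<c+m j j<m))

    block-structure : Block c m f g
    block-structure = record { top = top ; middle = middle ; bottom = bottom ; middle-< = middle-< }

    middle-centro132 : IsCentro132 m g
    middle-centro132 = record
      { injective       = g-injective
      ; surjective      = g-surjective
      ; avoids132       = g-avoids132
      ; centrosymmetric = g-centrosymmetric
      }
      where
      g-injective : ∀ i j → i < m → j < m → g i ≡ g j → i ≡ j
      g-injective i j i<m j<m gi≡gj = +-cancelˡ-≡ c i j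
        (injective G (c + i) (c + j) (middle-<n i<m) (middle-<n j<m)
          (trans (middle i i<m) (trans (cong (c +_) gi≡gj) (sym (middle j j<m)))))
      g-avoids132 : ∀ i j k → i < j → j < k → k < m → g i < g k → g k < g j → ⊥
      g-avoids132 i j k i<j j<k k<m gi<gk gk<gj =
        avoids132 G (c + i) (c + j) (c + k) (+-monoʳ-< c i<j) (+-monoʳ-< c j<k) (middle-<n k<m)
          (subst₂ _<_ (sym (middle i i<m)) (sym (middle k k<m)) (+-monoʳ-< c gi<gk))
          (subst₂ _<_ (sym (middle k k<m)) (sym (middle j j<m)) (+-monoʳ-< c gk<gj))
        where
        j<m = <-trans j<k k<m
        i<m = <-trans i<j j<m
      g-centrosymmetric : ∀ i j → suc (i + j) ≡ m → suc (g i + g j) ≡ m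
      g-centrosymmetric i j e = mirror-unshift c m (begin
        suc (c + g i + (c + g j))        ≡⟨ cong₂ (λ u v → suc (u + v)) (sym (middle i (mirrorˡ-< e)))
                                                                       (sym (middle j (mirrorʳ-< e))) ⟩
        suc (f (c + i) + f (c + j))      ≡⟨ centrosymmetric G (c + i) (c + j) (trans (mirror-shift c e) (sym n≡c+m+c)) ⟩
        n                                ≡⟨ n≡c+m+c ⟩
        c + m + c                        ∎)
        where open ≡-Reasoning
      g-surjective : ∀ v → v < m → ∃[ j ] (j < m × g j ≡ v)
      g-surjective v v<m with surjective G (c + v) (middle-<n v<m)
      ... | q , q<n , fq≡c+v with region c m (subst (q <_) n≡c+m+c q<n)
      ... | in-top q<c = ⊥-elim (<⇒≱ (+-monoʳ-< c v<m)
              (subst₂ _≤_ (+-comm m c) (trans (sym (top q q<c)) fq≡c+v) (m≤m+n (m + c) q)))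
      ... | in-middle {j} j<m = j , j<m , trans (cong (_∸ c) fq≡c+v) (m+n∸m≡n c v)
      ... | in-bottom {l} l<c = ⊥-elim (<⇒≱ l<c (subst (c ≤_) (trans (sym fq≡c+v) (bottom l l<c)) (m≤m+n c v)))

  decomposition : 1 ≤ c → Decomposition n f
  decomposition 1≤c with f 0 ≟ 0
  ... | yes f0≡0 = identity (λ i i<n → trans (full-run i (subst (i <_) (sym c≡n) i<n)) (cong (_+ i) f0≡0))
    where
    c≡n : c ≡ n
    c≡n = trans (sym (cong (_+ c) f0≡0)) f0+c≡n
  ... | no f0≢0 with c ≤? f 0
  ...   | no  c≰f0 = ⊥-elim (f0≢0 (f0<c⇒f0≡0 (≰⇒> c≰f0)))
  ...   | yes c≤f0 = block c m g 1≤c n≡c+m+c block-structure middle-centro132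
    where open Peel c≤f0

decompose : ∀ {n f} → IsCentro132 n f → Decomposition n f
decompose {zero}      G = identity (λ _ ())
decompose {suc n} {f} G = InitialRun.decomposition G (m+[n∸m]≡n (<⇒≤ f0<n)) (m<n⇒0<n∸m f0<n)
  where
  f0<n : f 0 < suc n
  f0<n = centro132-< G (s≤s z≤n)

module _ (P : ℕ → (ℕ → ℕ) → Set)
         (identity-case : ∀ {n f} → (∀ i → i < n → f i ≡ i) → P n f)
         (block-case : ∀ {c m f g} → 1 ≤ c → Block c m f g → IsCentro132 m g → P m g → P (c + m + c) f)
         where

  centro132-induction : ∀ n f → IsCentro132 n f → P n f
  centro132-induction = <-rec (λ n → ∀ f → IsCentro132 n f → P n f) step
    where
    step : ∀ n → (∀ {m} → m < n → ∀ g → IsCentro132 m g → P m g) → ∀ f → IsCentro132 n f → P n f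
    step n rec f G with decompose G
    ... | identity f≗id = identity-case f≗id
    ... | block c m g 1≤c refl B Gg =
      block-case 1≤c B Gg (rec (≤-trans (+-monoˡ-≤ m 1≤c) (m≤m+n (c + m) c)) g Gg)

centro132-involutive : ∀ n f → IsCentro132 n f → ∀ i → i < n → f (f i) ≡ i
centro132-involutive = centro132-induction (λ n f → ∀ i → i < n → f (f i) ≡ i)
  (λ {_} {f} f≗id i i<n → trans (cong f (f≗id i i<n)) (f≗id i i<n))
  (λ _ B _ g-invol → block-involutive B g-invol)

centro132-I+T≤D : ∀ n f → IsCentro132 n f → inversions n f + deficiencies n f ≤ displacement n f
centro132-I+T≤D = centro132-induction (λ n f → inversions n f + deficiencies n f ≤ displacement n f)
  (λ {n} {f} f≗id → ≤-reflexive (identity-shallow n f f≗id))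
  (λ 1≤c B _ g-I+T≤D → block-I+T≤D 1≤c B g-I+T≤D)

-- For k ≤ ⌊ n /2⌋, staircase n k is the involution (0 n∸1)(1 n∸2)⋯(k∸1 n∸k),
-- built one outer layer at a time.
staircase : ℕ → ℕ → ℕ → ℕ
staircase n             zero    i       = i
staircase zero          (suc k) i       = i
staircase (suc zero)    (suc k) i       = i
staircase (suc (suc m)) (suc k) zero    = suc m
staircase (suc (suc m)) (suc k) (suc j) = if j <ᵇ m then suc (staircase m k j) else 0

staircase-inside : ∀ m k {j} → j < m → staircase (suc (suc m)) (suc k) (suc j) ≡ suc (staircase m k j)
staircase-inside m k j<m rewrite <⇒<ᵇ≡true j<m = refl

staircase-last : ∀ m k → staircase (suc (suc m)) (suc k) (suc m) ≡ 0
staircase-last m k rewrite ≥⇒<ᵇ≡false (≤-refl {m}) = refl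

data Position (m : ℕ) : ℕ → Set where
  first  : Position m 0
  inside : ∀ {j} → j < m → Position m (suc j)
  last   : Position m (suc m)

position : ∀ m {i} → i < suc (suc m) → Position m i
position m {zero}  _ = first
position m {suc j} (s≤s j<1+m) with m<1+n⇒m<n∨m≡n j<1+m
... | inj₁ j<m  = inside j<m
... | inj₂ refl = last

staircase-< : ∀ n k {i} → i < n → staircase n k i < n
staircase-< n             zero    i<n = i<n
staircase-< (suc zero)    (suc k) i<n = i<n
staircase-< (suc (suc m)) (suc k) i<n with position m i<n
... | first = ≤-refl
... | inside {j} j<m rewrite staircase-inside m k j<m = s≤s (m<n⇒m<1+n (staircase-< m k j<m))
... | last rewrite staircase-last m k = s≤s z≤n

2+m≡1+m+1 : ∀ m → suc (suc m) ≡ 1 + m + 1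
2+m≡1+m+1 m = cong suc (+-comm 1 m)

m+1+0≡1+m : ∀ m → m + 1 + 0 ≡ 1 + m
m+1+0≡1+m m = trans (+-identityʳ (m + 1)) (+-comm m 1)

staircase-block : ∀ m k → Block 1 m (staircase (suc (suc m)) (suc k)) (staircase m k)
staircase-block m k = record
  { top      = λ { zero _ → sym (m+1+0≡1+m m) ; (suc i) (s≤s ()) }
  ; middle   = λ j j<m → staircase-inside m k j<m
  ; bottom   = λ { zero _ → trans (cong (staircase (suc (suc m)) (suc k) ∘ suc) (+-identityʳ m)) (staircase-last m k)
                 ; (suc i) (s≤s ()) }
  ; middle-< = λ j j<m → staircase-< m k j<m
  }

block-of-staircase : ∀ {m k f g} → Block 1 m f g → (∀ j → j < m → g j ≡ staircase m k j) →
  ∀ i → i < suc (suc m) → f i ≡ staircase (suc (suc m)) (suc k) i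
block-of-staircase {m} {k} {f} B g≗ i i<n with position m i<n
... | first = trans (Block.top B 0 (s≤s z≤n)) (m+1+0≡1+m m)
... | inside {j} j<m = trans (Block.middle B j j<m) (trans (cong suc (g≗ j j<m)) (sym (staircase-inside m k j<m)))
... | last = trans (cong (f ∘ suc) (sym (+-identityʳ m))) (trans (Block.bottom B 0 (s≤s z≤n)) (sym (staircase-last m k)))

staircase-involutive : ∀ n k → k ≤ ⌊ n /2⌋ → ∀ i → i < n → staircase n k (staircase n k i) ≡ i
staircase-involutive n             zero    _         i _   = refl
staircase-involutive (suc (suc m)) (suc k) (s≤s k≤m/2) i i<n =
  block-involutive (staircase-block m k) (staircase-involutive m k k≤m/2) i (subst (i <_) (2+m≡1+m+1 m) i<n)

staircase-shallow : ∀ n k → k ≤ ⌊ n /2⌋ → IsShallow n (staircase n k)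
staircase-shallow n             zero    _         = identity-shallow n _ (λ _ _ → refl)
staircase-shallow (suc (suc m)) (suc k) (s≤s k≤m/2) = subst (λ N → IsShallow N f) (sym (2+m≡1+m+1 m))
  (trans (block-I+T 1≤1 B) (trans (cong (_+ _) (staircase-shallow m k k≤m/2)) (sym (block-D 1≤1 B))))
  where
  f = staircase (suc (suc m)) (suc k)
  1≤1 : 1 ≤ 1
  1≤1 = s≤s z≤n
  B = staircase-block m k

staircase-avoids132 : ∀ n k → k ≤ ⌊ n /2⌋ → ∀ i j l → i < j → j < l → l < n →
  staircase n k i < staircase n k l → staircase n k l < staircase n k j → ⊥
staircase-avoids132 n zero _ i j l i<j j<l l<n si<sl sl<sj = <-asym j<l sl<sj
staircase-avoids132 (suc (suc m)) (suc k) (s≤s k≤m/2) i j l i<j j<l l<n si<sl sl<sj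
  with position m (<-trans i<j (<-trans j<l l<n))
... | first = <⇒≱ si<sl (≤-pred (staircase-< (suc (suc m)) (suc k) l<n))
... | last = <⇒≱ (<-trans i<j j<l) (≤-pred l<n)
... | inside {i′} i′<m with position m l<n | j | i<j | j<l
...   | last | _ | _ | _ = <⇒≱ (subst (staircase (suc (suc m)) (suc k) (suc i′) <_) (staircase-last m k) si<sl) z≤n
...   | inside {l′} l′<m | suc j′ | s≤s i′<j′ | s≤s j′<l′ =
  staircase-avoids132 m k k≤m/2 i′ j′ l′ i′<j′ j′<l′ l′<m
    (≤-pred (subst₂ _<_ (staircase-inside m k i′<m) (staircase-inside m k l′<m) si<sl))
    (≤-pred (subst₂ _<_ (staircase-inside m k l′<m) (staircase-inside m k (<-trans j′<l′ l′<m)) sl<sj))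

staircase-centrosymmetric : ∀ n k → k ≤ ⌊ n /2⌋ → ∀ i j → suc (i + j) ≡ n →
  suc (staircase n k i + staircase n k j) ≡ n
staircase-centrosymmetric n zero _ i j e = e
staircase-centrosymmetric (suc (suc m)) (suc k) (s≤s k≤m/2) i j e
  with position m (mirrorˡ-< {i} {j} e) | position m (mirrorʳ-< {i} {j} e)
... | first | last rewrite staircase-last m k = cong (suc ∘ suc) (+-identityʳ m)
... | last | first rewrite staircase-last m k = refl
... | inside {i′} i′<m | inside {j′} j′<m
  rewrite staircase-inside m k i′<m | staircase-inside m k j′<m =
  cong (suc ∘ suc) (trans (+-suc (staircase m k i′) (staircase m k j′))
    (staircase-centrosymmetric m k k≤m/2 i′ j′ (trans (sym (+-suc i′ j′)) (suc-injective (suc-injective e)))))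
... | first | first = ⊥-elim (0≢1+n (suc-injective e))
... | first | inside j′<m = ⊥-elim (<-irrefl (suc-injective (suc-injective e)) j′<m)
... | inside {i′} i′<m | first = ⊥-elim (<-irrefl (trans (sym (+-identityʳ i′)) (suc-injective (suc-injective e))) i′<m)
... | inside {i′} _ | last = ⊥-elim (m+1+n≢n i′ (suc-injective (suc-injective e)))
... | last | inside _ = ⊥-elim (m+1+n≢m (suc m) (suc-injective e))
... | last | last = ⊥-elim (m+1+n≢m (suc m) (suc-injective e))

staircase-centro132 : ∀ n k → k ≤ ⌊ n /2⌋ → IsCentro132 n (staircase n k)
staircase-centro132 n k k≤n/2 = record
  { injective       = λ i j i<n j<n si≡sj →
                        trans (sym (invol i i<n)) (trans (cong (staircase n k) si≡sj) (invol j j<n))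
  ; surjective      = λ v v<n → staircase n k v , staircase-< n k v<n , invol v v<n
  ; avoids132       = staircase-avoids132 n k k≤n/2
  ; centrosymmetric = staircase-centrosymmetric n k k≤n/2
  }
  where
  invol = staircase-involutive n k k≤n/2

staircase-injective : ∀ n {k l} → k ≤ ⌊ n /2⌋ → l ≤ ⌊ n /2⌋ →
  (∀ i → i < n → staircase n k i ≡ staircase n l i) → k ≡ l
staircase-injective n             {zero}  {zero}  _ _ _ = refl
staircase-injective (suc (suc m)) {zero}  {suc l} _ _ same = ⊥-elim (0≢1+n (same 0 (s≤s z≤n)))
staircase-injective (suc (suc m)) {suc k} {zero}  _ _ same = ⊥-elim (0≢1+n (sym (same 0 (s≤s z≤n))))
staircase-injective (suc (suc m)) {suc k} {suc l} (s≤s k≤m/2) (s≤s l≤m/2) same =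
  cong suc (staircase-injective m k≤m/2 l≤m/2 λ i i<m → suc-injective (begin
    suc (staircase m k i)                    ≡⟨ sym (staircase-inside m k i<m) ⟩
    staircase (suc (suc m)) (suc k) (suc i)  ≡⟨ same (suc i) (s≤s (m<n⇒m<1+n i<m)) ⟩
    staircase (suc (suc m)) (suc l) (suc i)  ≡⟨ staircase-inside m l i<m ⟩
    suc (staircase m l i)                    ∎))
  where open ≡-Reasoning

IsStaircase : ℕ → (ℕ → ℕ) → Set
IsStaircase n f = ∃[ k ] (k ≤ ⌊ n /2⌋ × (∀ i → i < n → f i ≡ staircase n k i))

centro132-shallow⇒staircase : ∀ n f → IsCentro132 n f → IsShallow n f → IsStaircase n f
centro132-shallow⇒staircase = centro132-induction (λ n f → IsShallow n f → IsStaircase n f)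
  (λ f≗id _ → 0 , z≤n , f≗id)
  peel-layer
  where
  peel-layer : ∀ {c m f g} → 1 ≤ c → Block c m f g → IsCentro132 m g →
    (IsShallow m g → IsStaircase m g) → IsShallow (c + m + c) f → IsStaircase (c + m + c) f
  peel-layer {m = m} {f} 1≤c B Gg g-staircase f-shallow with block-shallow 1≤c B (centro132-I+T≤D _ _ Gg) f-shallow
  ... | refl , g-shallow with g-staircase g-shallow
  ... | k , k≤m/2 , g≗ = subst (λ N → IsStaircase N f) (2+m≡1+m+1 m) (suc k , s≤s k≤m/2 , block-of-staircase B g≗)

fin-injective⇒surjective : ∀ {n} (h : Fin n → Fin n) → (∀ x y → h x ≡ h y → x ≡ y) →
  ∀ y → ∃[ x ] (h x ≡ y)
fin-injective⇒surjective {suc n} h h-injective y with any? (λ x → h x ≟ᶠ y)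
... | yes hit  = hit
... | no  miss = ⊥-elim (collision (pigeonhole (n<1+n n) (λ x → punchOut (avoids x))))
  where
  avoids : ∀ x → y ≢ h x
  avoids x y≡hx = miss (x , sym y≡hx)
  collision : ∃[ x ] ∃[ x′ ] (x Fin.< x′ × punchOut (avoids x) ≡ punchOut (avoids x′)) → ⊥
  collision (x , x′ , x<x′ , same) =
    <-irrefl (cong toℕ (h-injective x x′ (punchOut-injective (avoids x) (avoids x′) same))) x<x′

sum-allFin : ∀ n (h : Fin n → ℕ) (h′ : ℕ → ℕ) → (∀ x → h x ≡ h′ (toℕ x)) →
  sum (map h (allFin n)) ≡ ∑< n h′
sum-allFin n h h′ h≗h′ = trans (cong sum (map-tabulate (λ x → x) h)) (sum-tabulate n h h′ h≗h′)
  where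
  sum-tabulate : ∀ n (h : Fin n → ℕ) (h′ : ℕ → ℕ) → (∀ x → h x ≡ h′ (toℕ x)) →
    sum (Data.List.tabulate h) ≡ ∑< n h′
  sum-tabulate zero    h h′ h≗h′ = refl
  sum-tabulate (suc n) h h′ h≗h′ =
    cong₂ _+_ (h≗h′ Fin.zero) (sum-tabulate n (h ∘ Fin.suc) (h′ ∘ suc) (h≗h′ ∘ Fin.suc))

valℕ : ∀ {n m} → Vec (Fin n) m → ℕ → ℕ
valℕ []       _       = 0
valℕ (x ∷ xs) zero    = toℕ x
valℕ (x ∷ xs) (suc i) = valℕ xs i

toℕ-lookup≡valℕ : ∀ {n m} (v : Vec (Fin n) m) x → toℕ (lookup v x) ≡ valℕ v (toℕ x)
toℕ-lookup≡valℕ (_ ∷ _) Fin.zero    = refl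
toℕ-lookup≡valℕ (_ ∷ v) (Fin.suc x) = toℕ-lookup≡valℕ v x

module AsFunction {n : ℕ} (π : Word n) (f : ℕ → ℕ) (π≗f : ∀ x → val π x ≡ f (toℕ x)) where

  D≡displacement : D π ≡ displacement n f
  D≡displacement = sum-allFin n _ _ λ x → cong (∣_- toℕ x ∣) (π≗f x)

  I≡inversions : I π ≡ inversions n f
  I≡inversions = sum-allFin n _ _ λ x → sum-allFin n _ _ λ y →
    cong₂ (λ u v → b2n ((toℕ x <ᵇ toℕ y) ∧ (u <ᵇ v))) (π≗f y) (π≗f x)

  module _ (f-invol : ∀ i → i < n → f (f i) ≡ i) where

    iter-involution : ∀ k x → iter π k x ≡ x ⊎ iter π k x ≡ lookup π x
    iter-involution zero    x = inj₁ refl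
    iter-involution (suc k) x with iter-involution k x
    ... | inj₁ πᵏx≡x  = inj₂ (cong (lookup π) πᵏx≡x)
    ... | inj₂ πᵏx≡πx = inj₁ (trans (cong (lookup π) πᵏx≡πx) π²x≡x)
      where
      π²x≡x : lookup π (lookup π x) ≡ x
      π²x≡x = toℕ-injective (trans (π≗f (lookup π x)) (trans (cong f (π≗f x)) (f-invol (toℕ x) (toℕ<n x))))

    -- upTo n begins 0 ∷ 1 ∷ …, so the test sees x and π x first; every later iterate is one of these.
    isCycleMin-involution : 2 ≤ n → ∀ x → isCycleMin π x ≡ (toℕ x ≤ᵇ val π x)
    isCycleMin-involution (s≤s (s≤s {n = n′} _)) x =
      trans (cong (_∧ ((toℕ x ≤ᵇ val π x) ∧ and (map test later))) (≤⇒≤ᵇ≡true (≤-refl {toℕ x})))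
            (∧-and-absorb (toℕ x ≤ᵇ val π x)
              (All.map⁺ (All.applyUpTo⁺₂ _ n′ (λ k → test-values (suc (suc k))))))
      where
      later = applyUpTo (suc ∘ suc) n′
      test : ℕ → Bool
      test k = toℕ x ≤ᵇ toℕ (iter π k x)
      test-values : ∀ k → test k ≡ true ⊎ test k ≡ (toℕ x ≤ᵇ val π x)
      test-values k with iter-involution k x
      ... | inj₁ πᵏx≡x  =
        inj₁ (trans (cong (λ y → toℕ x ≤ᵇ toℕ y) πᵏx≡x) (≤⇒≤ᵇ≡true (≤-refl {toℕ x})))
      ... | inj₂ πᵏx≡πx = inj₂ (cong (λ y → toℕ x ≤ᵇ toℕ y) πᵏx≡πx)

    T≡deficiencies : 2 ≤ n → T π ≡ deficiencies n f
    T≡deficiencies 2≤n = begin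
      n ∸ cyc π                         ≡⟨ cong (n ∸_) cyc≡above ⟩
      n ∸ above                         ≡⟨ cong (_∸ above) (sym above+deficiencies≡n) ⟩
      above + deficiencies n f ∸ above  ≡⟨ m+n∸m≡n above _ ⟩
      deficiencies n f                  ∎
      where
      open ≡-Reasoning
      above = ∑< n (λ i → b2n (i ≤ᵇ f i))
      cyc≡above : cyc π ≡ above
      cyc≡above = sum-allFin n _ _ λ x →
        cong b2n (trans (isCycleMin-involution 2≤n x) (cong (toℕ x ≤ᵇ_) (π≗f x)))
      above+deficiencies≡n : above + deficiencies n f ≡ n
      above+deficiencies≡n = trans (sym (∑<-+ n _ _)) (∑<-one n (λ i _ → b2n-≤ᵇ+b2n-<ᵇ i (f i)))

  f-at : ∀ {i} (i<n : i < n) → f i ≡ val π (fromℕ< i<n)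
  f-at i<n = trans (cong f (sym (toℕ-fromℕ< i<n))) (sym (π≗f (fromℕ< i<n)))

  module _ (G : IsCentro132 n f) where

    centro132⇒isPerm : IsPerm π
    centro132⇒isPerm x y πx≡πy = toℕ-injective (injective G (toℕ x) (toℕ y) (toℕ<n x) (toℕ<n y)
      (trans (sym (π≗f x)) (trans (cong toℕ πx≡πy) (π≗f y))))

    centro132⇒avoids132 : Avoids132 π
    centro132⇒avoids132 (x , y , z , x<y , y<z , πx<πz , πz<πy) =
      avoids132 G (toℕ x) (toℕ y) (toℕ z) x<y y<z (toℕ<n z)
        (subst₂ _<_ (π≗f x) (π≗f z) πx<πz) (subst₂ _<_ (π≗f z) (π≗f y) πz<πy)

    centro132⇒centrosymmetric : Centrosymmetric π
    centro132⇒centrosymmetric =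
      trans (sym (tabulate∘lookup π)) (tabulate-cong λ x → toℕ-injective (sym (mirrored x)))
      where
      mirrored : ∀ x → toℕ (opposite (lookup π (opposite x))) ≡ toℕ (lookup π x)
      mirrored x = begin
        toℕ (opposite (lookup π (opposite x)))  ≡⟨ opposite-prop _ ⟩
        n ∸ suc (val π (opposite x))            ≡⟨ cong (λ u → n ∸ suc u) (π≗f (opposite x)) ⟩
        n ∸ suc (f (toℕ (opposite x)))          ≡⟨ cong (λ u → n ∸ suc (f u)) (opposite-prop x) ⟩
        n ∸ suc (f j)                           ≡⟨ cong (_∸ suc (f j)) (sym fi+fj≡n) ⟩
        f i + suc (f j) ∸ suc (f j)             ≡⟨ m+n∸n≡m (f i) (suc (f j)) ⟩
        f i                                     ≡⟨ sym (π≗f x) ⟩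
        toℕ (lookup π x)                        ∎
        where
        open ≡-Reasoning
        i = toℕ x
        j = n ∸ suc i
        fi+fj≡n : f i + suc (f j) ≡ n
        fi+fj≡n = trans (+-suc (f i) (f j)) (centrosymmetric G i j (m+[n∸m]≡n (toℕ<n x)))

  good⇒centro132 : IsPerm π → Avoids132 π → Centrosymmetric π → IsCentro132 n f
  good⇒centro132 perm avoids centro = record
    { injective       = f-injective
    ; surjective      = f-surjective
    ; avoids132       = f-avoids132
    ; centrosymmetric = f-centrosymmetric
    }
    where
    f-injective : ∀ i j → i < n → j < n → f i ≡ f j → i ≡ j
    f-injective i j i<n j<n fi≡fj = begin
      i                      ≡⟨ sym (toℕ-fromℕ< i<n) ⟩
      toℕ (fromℕ< i<n)       ≡⟨ cong toℕ (perm _ _ πi≡πj) ⟩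
      toℕ (fromℕ< j<n)       ≡⟨ toℕ-fromℕ< j<n ⟩
      j                      ∎
      where
      open ≡-Reasoning
      πi≡πj : lookup π (fromℕ< i<n) ≡ lookup π (fromℕ< j<n)
      πi≡πj = toℕ-injective (trans (sym (f-at i<n)) (trans fi≡fj (f-at j<n)))
    f-surjective : ∀ v → v < n → ∃[ i ] (i < n × f i ≡ v)
    f-surjective v v<n with fin-injective⇒surjective (lookup π) perm (fromℕ< v<n)
    ... | x , πx≡v = toℕ x , toℕ<n x , trans (sym (π≗f x)) (trans (cong toℕ πx≡v) (toℕ-fromℕ< v<n))
    f-avoids132 : ∀ i j k → i < j → j < k → k < n → f i < f k → f k < f j → ⊥
    f-avoids132 i j k i<j j<k k<n fi<fk fk<fj = avoids (fromℕ< i<n , fromℕ< j<n , fromℕ< k<n ,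
        subst₂ _<_ (sym (toℕ-fromℕ< i<n)) (sym (toℕ-fromℕ< j<n)) i<j ,
        subst₂ _<_ (sym (toℕ-fromℕ< j<n)) (sym (toℕ-fromℕ< k<n)) j<k ,
        subst₂ _<_ (f-at i<n) (f-at k<n) fi<fk ,
        subst₂ _<_ (f-at k<n) (f-at j<n) fk<fj)
      where
      j<n = <-trans j<k k<n
      i<n = <-trans i<j j<n
    f-centrosymmetric : ∀ i j → suc (i + j) ≡ n → suc (f i + f j) ≡ n
    f-centrosymmetric i j e = trans (sym (+-suc (f i) (f j))) (trans (cong (_+ suc (f j)) fi≡) (m∸n+n≡m fj<n))
      where
      i<n = mirrorˡ-< {i} {j} e
      j<n = mirrorʳ-< {i} {j} e
      x = fromℕ< i<n
      fj<n : f j < n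
      fj<n = subst (_< n) (sym (f-at j<n)) (toℕ<n _)
      opposite-x : toℕ (opposite x) ≡ j
      opposite-x = trans (opposite-prop x) (trans (cong (λ u → n ∸ suc u) (toℕ-fromℕ< i<n))
                     (trans (cong (_∸ suc i) (sym e)) (m+n∸m≡n (suc i) j)))
      fi≡ : f i ≡ n ∸ suc (f j)
      fi≡ = begin
        f i                                     ≡⟨ f-at i<n ⟩
        val π x                                 ≡⟨ cong (λ σ → toℕ (lookup σ x)) centro ⟩
        toℕ (lookup (rc π) x)                   ≡⟨ cong toℕ (lookup∘tabulate _ x) ⟩
        toℕ (opposite (lookup π (opposite x)))  ≡⟨ opposite-prop _ ⟩
        n ∸ suc (val π (opposite x))            ≡⟨ cong (λ u → n ∸ suc u) (π≗f (opposite x)) ⟩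
        n ∸ suc (f (toℕ (opposite x)))          ≡⟨ cong (λ u → n ∸ suc (f u)) opposite-x ⟩
        n ∸ suc (f j)                           ∎
        where open ≡-Reasoning

word-ext : ∀ {n} {π σ : Word n} → (∀ x → val π x ≡ val σ x) → π ≡ σ
word-ext {π = π} {σ} π≗σ =
  trans (sym (tabulate∘lookup π)) (trans (tabulate-cong (toℕ-injective ∘ π≗σ)) (tabulate∘lookup σ))

staircaseWord : ∀ n → ℕ → Word n
staircaseWord n k = tabulate (λ x → fromℕ< (staircase-< n k (toℕ<n x)))

staircaseWord-val : ∀ n k x → val (staircaseWord n k) x ≡ staircase n k (toℕ x)
staircaseWord-val n k x = trans (cong toℕ (lookup∘tabulate _ x)) (toℕ-fromℕ< _)

staircaseWord-good : ∀ {n k} → 2 ≤ n → k ≤ ⌊ n /2⌋ → Good (staircaseWord n k)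
staircaseWord-good {n} {k} 2≤n k≤n/2 =
  centro132⇒isPerm G , shallow , centro132⇒avoids132 G , centro132⇒centrosymmetric G
  where
  open AsFunction (staircaseWord n k) (staircase n k) (staircaseWord-val n k)
  G = staircase-centro132 n k k≤n/2
  shallow : Shallow (staircaseWord n k)
  shallow = trans (cong₂ _+_ I≡inversions (T≡deficiencies (staircase-involutive n k k≤n/2) 2≤n))
                  (trans (staircase-shallow n k k≤n/2) (sym D≡displacement))

good⇒staircaseWord : ∀ {n} → 2 ≤ n → (π : Word n) → Good π →
  ∃[ k ] (k ≤ ⌊ n /2⌋ × π ≡ staircaseWord n k)
good⇒staircaseWord {n} 2≤n π (perm , shallow , avoids , centro) =
  as-word (centro132-shallow⇒staircase n f G f-shallow)
  where
  f = valℕ π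
  π≗f = toℕ-lookup≡valℕ π
  open AsFunction π f π≗f
  G = good⇒centro132 perm avoids centro
  f-shallow : IsShallow n f
  f-shallow = trans (sym (cong₂ _+_ I≡inversions (T≡deficiencies (centro132-involutive n f G) 2≤n)))
                    (trans shallow D≡displacement)
  as-word : IsStaircase n f → ∃[ k ] (k ≤ ⌊ n /2⌋ × π ≡ staircaseWord n k)
  as-word (k , k≤n/2 , f≗staircase) = k , k≤n/2 , word-ext λ x →
    trans (π≗f x) (trans (f≗staircase (toℕ x) (toℕ<n x)) (sym (staircaseWord-val n k x)))

staircaseWord-injective : ∀ n {k l} → k ≤ ⌊ n /2⌋ → l ≤ ⌊ n /2⌋ →
  staircaseWord n k ≡ staircaseWord n l → k ≡ l
staircaseWord-injective n {k} {l} k≤n/2 l≤n/2 same = staircase-injective n k≤n/2 l≤n/2 λ i i<n → begin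
  staircase n k i                       ≡⟨ cong (staircase n k) (sym (toℕ-fromℕ< i<n)) ⟩
  staircase n k (toℕ (fromℕ< i<n))      ≡⟨ sym (staircaseWord-val n k (fromℕ< i<n)) ⟩
  val (staircaseWord n k) (fromℕ< i<n)  ≡⟨ cong (λ σ → val σ (fromℕ< i<n)) same ⟩
  val (staircaseWord n l) (fromℕ< i<n)  ≡⟨ staircaseWord-val n l (fromℕ< i<n) ⟩
  staircase n l (toℕ (fromℕ< i<n))      ≡⟨ cong (staircase n l) (toℕ-fromℕ< i<n) ⟩
  staircase n l i                       ∎
  where open ≡-Reasoning

staircaseWords : ∀ n → List (Word n)
staircaseWords n = applyUpTo (staircaseWord n) (suc ⌊ n /2⌋)

staircaseWords-unique : ∀ n → Unique (staircaseWords n)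
staircaseWords-unique n = Unique.applyUpTo⁺₁ (staircaseWord n) (suc ⌊ n /2⌋) λ k<l l<N →
  <⇒≢ k<l ∘ staircaseWord-injective n (≤-pred (<-trans k<l l<N)) (≤-pred l<N)

∈-staircaseWords⇒good : ∀ {n} → 2 ≤ n → ∀ {π} → π ∈ staircaseWords n → Good π
∈-staircaseWords⇒good {n} 2≤n π∈ with k , k<N , π≡ ← ∈-applyUpTo⁻ (staircaseWord n) π∈ =
  subst Good (sym π≡) (staircaseWord-good 2≤n (≤-pred k<N))

good⇒∈-staircaseWords : ∀ {n} → 2 ≤ n → ∀ π → Good π → π ∈ staircaseWords n
good⇒∈-staircaseWords {n} 2≤n π good = listed (good⇒staircaseWord 2≤n π good)
  where
  listed : ∃[ k ] (k ≤ ⌊ n /2⌋ × π ≡ staircaseWord n k) → π ∈ staircaseWords n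
  listed (k , k≤n/2 , π≡) = subst (_∈ staircaseWords n) (sym π≡) (∈-applyUpTo⁺ (staircaseWord n) (s≤s k≤n/2))

theorem3p7 : (n : ℕ) → 2 ≤ n →
    Σ (List (Word n)) (λ L →
      Unique L × (∀ π → (π ∈ L) ⇔ Good π) × length L ≡ ⌈ suc n /2⌉)
theorem3p7 n 2≤n =
    staircaseWords n
  , staircaseWords-unique n
  , (λ π → mk⇔ (∈-staircaseWords⇒good 2≤n) (good⇒∈-staircaseWords 2≤n π))
  , length-applyUpTo (staircaseWord n) (suc ⌊ n /2⌋)
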